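{- Let $R$ be a local commutative ring with unity of characteristic $p^{\alpha}$ ($p$ prime). Let $g(x)\in p^kR[x]\setminus p^{k+1}R[x]$ for some $k\ge 0$, write $g(x)=p^k\hat{g}(x)$, and let $\hat{I}=\{r\in R: p^kr=0\}$. Suppose $q_1(x),q_2(x)$ are monic polynomials in $R[x]$ each of which divides $g$ in $R[x]$, and suppose there exist $a(x),b(x)\in R[x]$ such that $aq_1+bq_2=1$ in $(R/(\hat{I}+pR))[x]$. Then $q_1q_2$ divides $\hat{g}$ in $(R/(\hat{I}+pR))[x]$.
   Context: A local ring is a commutative ring with unity that has a unique maximal ideal. $pR$ denotes the ideal $\{pr:r\in R\}$. -}

module Defs where

open import Level using (Level; _⊔_; suc)
open import Algebra.Bundles using (CommutativeRing)
open import Data.Nat using (ℕ; zero; _^_)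
open import Relation.Binary.PropositionalEquality using (_≡_)
open import Data.Nat.Divisibility using (_∣_)
open import Data.Unit.Polymorphic using (⊤)
import Data.Nat
open import Data.List using (List; []; _∷_; map; _∷ʳ_)
open import Data.Product using (Σ; ∃; _×_; _,_)
open import Relation.Nullary using (¬_)

module RingDefs {c ℓ : Level} (R : CommutativeRing c ℓ) where
  open CommutativeRing R

  ℕ→R : ℕ → Carrier
  ℕ→R zero = 0#
  ℕ→R (Data.Nat.suc n) = 1# + ℕ→R n

  Pred : Set (suc (c ⊔ ℓ))
  Pred = Carrier → Set (c ⊔ ℓ)

  _⊆_ : Pred → Pred → Set (c ⊔ ℓ)
  I ⊆ J = ∀ {x} → I x → J x

  record IsIdeal (I : Pred) : Set (c ⊔ ℓ) where
    field
      resp  : ∀ {x y} → x ≈ y → I x → I y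
      zero∈ : I 0#
      +∈    : ∀ {x y} → I x → I y → I (x + y)
      *∈    : ∀ {y} x → I y → I (x * y)

  record IsMaximalIdeal (M : Pred) : Set (suc (c ⊔ ℓ)) where
    field
      ideal    : IsIdeal M
      proper   : ¬ M 1#
      maximal  : ∀ (J : Pred) → IsIdeal J → ¬ J 1# → M ⊆ J → J ⊆ M

  IsLocal : Set (suc (c ⊔ ℓ))
  IsLocal = Σ Pred λ M → IsMaximalIdeal M ×
              (∀ (N : Pred) → IsMaximalIdeal N → (N ⊆ M) × (M ⊆ N))

  HasCharacteristic : ℕ → Set ℓ
  HasCharacteristic n = (ℕ→R n ≈ 0#) × (∀ m → ℕ→R m ≈ 0# → n ∣ m)

  -- Polynomials: coefficient lists, constant term first
  Poly : Set c
  Poly = List Carrier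

  _+P_ : Poly → Poly → Poly
  [] +P q = q
  (a ∷ p) +P [] = a ∷ p
  (a ∷ p) +P (b ∷ q) = (a + b) ∷ (p +P q)

  _·P_ : Carrier → Poly → Poly
  a ·P q = map (a *_) q

  _*P_ : Poly → Poly → Poly
  [] *P q = []
  (a ∷ p) *P q = (a ·P q) +P (0# ∷ (p *P q))

  -- equality of polynomials coefficientwise w.r.t. a relation on
  -- coefficients (missing coefficients count as 0)
  PolyEq : ∀ {ℓ'} → (Carrier → Carrier → Set ℓ') → Poly → Poly → Set ℓ'
  PolyEq _~_ [] [] = ⊤
  PolyEq _~_ [] (b ∷ q) = (0# ~ b) × PolyEq _~_ [] q
  PolyEq _~_ (a ∷ p) [] = (a ~ 0#) × PolyEq _~_ p []
  PolyEq _~_ (a ∷ p) (b ∷ q) = (a ~ b) × PolyEq _~_ p q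

  _≈P_ : Poly → Poly → Set ℓ
  _≈P_ = PolyEq _≈_

  _∣P_ : Poly → Poly → Set (c ⊔ ℓ)
  q ∣P g = Σ Poly λ h → g ≈P (q *P h)

  Monic : Poly → Set (c ⊔ ℓ)
  Monic q = Σ Poly λ cs → Σ Carrier λ u → (q ≡ cs ∷ʳ u) × (u ≈ 1#)

  -- the ideal Î + pR where Î = {r : p^k r = 0}; congruence modulo it,
  -- i.e. equality in R/(Î + pR)
  _≡[mod-Î+pR]_ : (p k : ℕ) → Carrier → Carrier → Set (c ⊔ ℓ)
  _≡[mod-Î+pR]_ p k x y =
    Σ Carrier λ i → Σ Carrier λ r →
      (ℕ→R (p ^ k) * i ≈ 0#) × (x - y ≈ i + ℕ→R p * r)

  _≈Q[_,_]_ : Poly → ℕ → ℕ → Poly → Set (c ⊔ ℓ)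
  f ≈Q[ p , k ] g = PolyEq (_≡[mod-Î+pR]_ p k) f g

  _∣Q[_,_]_ : Poly → ℕ → ℕ → Poly → Set (c ⊔ ℓ)
  q ∣Q[ p , k ] g = Σ Poly λ h → g ≈Q[ p , k ] (q *P h)

module Submission where

-- Put c = pᵏ. If a monic q divides g = c ĝ, say g = q h, then h q ≡ 0 modulo c; as q is monic its
-- top coefficient is a unit, so h ≡ 0 modulo c, i.e. h = c h′. Then c ĝ = c q h′, so ĝ ≡ q h′
-- modulo Î = Ann(c). Hence both q₁ and q₂ divide ĝ modulo Î + pR, where a q₁ + b q₂ ≡ 1 gives
-- ĝ ≡ (a q₁ + b q₂) ĝ ≡ q₁ q₂ (a s₂ + b s₁).

open import Defs
open import Level using (Level; _⊔_)
open import Algebra.Bundles using (CommutativeRing; CommutativeMonoid; CommutativeSemiring)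
open import Algebra.Definitions using (Congruent₂)
open import Data.Nat as ℕ using (ℕ; zero; suc; _^_; _<_; s≤s)
open import Data.Nat.Properties using (m≤n+m)
open import Data.Nat.Primality using (Prime)
open import Data.List using ([]; _∷_; _∷ʳ_; length)
open import Data.List.Reverse using (Reverse; reverseView; []; _∶_∶ʳ_)
open import Data.Product using (Σ; _×_; _,_; map₂)
open import Data.Unit.Polymorphic using (tt)
open import Relation.Binary.Core using (Rel; _⇒_)
open import Relation.Binary.Bundles using (Setoid)
open import Relation.Binary.Structures using (IsEquivalence)
open import Relation.Binary.PropositionalEquality as ≡ using (_≡_)
open import Relation.Nullary using (¬_)
import Relation.Binary.Reasoning.Setoid as SetoidReasoning

module Polynomials {c ℓ : Level} (R : CommutativeRing c ℓ) where
  open CommutativeRing R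
  open RingDefs R
  open import Algebra.Properties.Ring ring using (-1*x≈-x; x[y-z]≈xy-xz; [y-z]x≈yx-zx)
  open import Algebra.Properties.AbelianGroup +-abelianGroup using (⁻¹-anti-homo‿-; ⁻¹-∙-comm)
  open import Algebra.Properties.Group +-group using (x≈y⇒x∙y⁻¹≈ε; ε⁻¹≈ε)
  open import Algebra.Properties.CommutativeSemigroup +-commutativeSemigroup
    using (interchange)
  open import Algebra.Properties.CommutativeSemigroup *-commutativeSemigroup
    using () renaming (x∙yz≈y∙xz to *-x∙yz≈y∙xz)

  record IsCongruence {ℓ′} (_~_ : Rel Carrier ℓ′) : Set (c ⊔ ℓ ⊔ ℓ′) where
    field
      isEquivalence : IsEquivalence _~_
      ≈⇒~           : _≈_ ⇒ _~_
      +-cong        : Congruent₂ _~_ _+_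
      *-cong        : Congruent₂ _~_ _*_

  ≈-isCongruence : IsCongruence _≈_
  ≈-isCongruence = record
    { isEquivalence = isEquivalence ; ≈⇒~ = λ e → e ; +-cong = +-cong ; *-cong = *-cong }

  -1*[x-y]≈y-x : ∀ x y → - 1# * (x - y) ≈ y - x
  -1*[x-y]≈y-x x y = trans (-1*x≈-x (x - y)) (⁻¹-anti-homo‿- x y)

  [x-y]+[y-z]≈x-z : ∀ x y z → (x - y) + (y - z) ≈ x - z
  [x-y]+[y-z]≈x-z x y z = begin
    (x - y) + (y - z)    ≈⟨ +-assoc x (- y) (y - z) ⟩
    x + (- y + (y - z))  ≈⟨ +-congˡ (sym (+-assoc (- y) y (- z))) ⟩
    x + ((- y + y) - z)  ≈⟨ +-congˡ (+-congʳ (-‿inverseˡ y)) ⟩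
    x + (0# - z)         ≈⟨ +-congˡ (+-identityˡ (- z)) ⟩
    x - z                ∎
    where open SetoidReasoning setoid

  [x+y]-[u+v]≈[x-u]+[y-v] : ∀ x y u v → (x + y) - (u + v) ≈ (x - u) + (y - v)
  [x+y]-[u+v]≈[x-u]+[y-v] x y u v = begin
    (x + y) - (u + v)      ≈⟨ +-congˡ (sym (⁻¹-∙-comm u v)) ⟩
    (x + y) + (- u + - v)  ≈⟨ interchange x y (- u) (- v) ⟩
    (x - u) + (y - v)      ∎
    where open SetoidReasoning setoid

  xy-uv≈x[y-v]+[x-u]v : ∀ x y u v → x * y - u * v ≈ x * (y - v) + (x - u) * v
  xy-uv≈x[y-v]+[x-u]v x y u v = begin
    x * y - u * v                        ≈⟨ [x-y]+[y-z]≈x-z (x * y) (x * v) (u * v) ⟨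
    (x * y - x * v) + (x * v - u * v)    ≈⟨ +-cong (x[y-z]≈xy-xz x y v) ([y-z]x≈yx-zx v x u) ⟨
    x * (y - v) + (x - u) * v            ∎
    where open SetoidReasoning setoid

  ideal⇒isCongruence : ∀ {J} → IsIdeal J → IsCongruence (λ x y → J (x - y))
  ideal⇒isCongruence {J} J-ideal = record
    { isEquivalence = record
        { refl  = λ {x} → ≈⇒J refl
        ; sym   = λ {x} {y} j → resp (-1*[x-y]≈y-x x y) (*∈ (- 1#) j)
        ; trans = λ {x} {y} {z} j k → resp ([x-y]+[y-z]≈x-z x y z) (+∈ j k)
        }
    ; ≈⇒~    = ≈⇒J
    ; +-cong = λ {x} {u} {y} {v} j k → resp (sym ([x+y]-[u+v]≈[x-u]+[y-v] x y u v)) (+∈ j k)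
    ; *-cong = λ {x} {u} {y} {v} j k →
        resp (sym (xy-uv≈x[y-v]+[x-u]v x y u v)) (+∈ (*∈ x k) (resp (*-comm v (x - u)) (*∈ v j)))
    }
    where
      open IsIdeal J-ideal
      ≈⇒J : ∀ {x y} → x ≈ y → J (x - y)
      ≈⇒J e = resp (sym (x≈y⇒x∙y⁻¹≈ε e)) zero∈

  Multiples : Carrier → Pred
  Multiples d z = Σ Carrier λ r → z ≈ d * r

  multiples-isIdeal : ∀ d → IsIdeal (Multiples d)
  multiples-isIdeal d = record
    { resp  = λ { e (r , z≈dr) → r , trans (sym e) z≈dr }
    ; zero∈ = 0# , sym (zeroʳ d)
    ; +∈    = λ { (r , x≈dr) (s , y≈ds) → r + s , trans (+-cong x≈dr y≈ds) (sym (distribˡ d r s)) }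
    ; *∈    = λ { x (r , y≈dr) → x * r , trans (*-congˡ y≈dr) (*-x∙yz≈y∙xz x d r) }
    }

  CongruentModAnn : Carrier → Rel Carrier ℓ
  CongruentModAnn d x y = d * (x - y) ≈ 0#

  AnnPlusMultiples : Carrier → Carrier → Pred
  AnnPlusMultiples a d z = Σ Carrier λ i → Σ Carrier λ r → (a * i ≈ 0#) × (z ≈ i + d * r)

  annPlusMultiples-isIdeal : ∀ a d → IsIdeal (AnnPlusMultiples a d)
  annPlusMultiples-isIdeal a d = record
    { resp  = λ { e (i , r , ai≈0 , z≈) → i , r , ai≈0 , trans (sym e) z≈ }
    ; zero∈ = 0# , 0# , zeroʳ a , sym (trans (+-congˡ (zeroʳ d)) (+-identityʳ 0#))
    ; +∈    = λ { (i , r , ai≈0 , x≈) (j , s , aj≈0 , y≈) →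
                  i + j , r + s
                  , trans (distribˡ a i j) (trans (+-cong ai≈0 aj≈0) (+-identityʳ 0#))
                  , trans (+-cong x≈ y≈) (trans (interchange i (d * r) j (d * s))
                                                (+-congˡ (sym (distribˡ d r s)))) }
    ; *∈    = λ { x (i , r , ai≈0 , y≈) →
                  x * i , x * r
                  , trans (*-x∙yz≈y∙xz a x i) (trans (*-congˡ ai≈0) (zeroʳ x))
                  , trans (*-congˡ y≈) (trans (distribˡ x i (d * r)) (+-congˡ (*-x∙yz≈y∙xz x d r))) }
    }

  coeff : Poly → ℕ → Carrier
  coeff []      n       = 0#
  coeff (a ∷ p) zero    = a
  coeff (a ∷ p) (suc n) = coeff p n

  coeff-+P : ∀ p q n → coeff (p +P q) n ≈ coeff p n + coeff q n
  coeff-+P []      q       n       = sym (+-identityˡ _)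
  coeff-+P (a ∷ p) []      n       = sym (+-identityʳ _)
  coeff-+P (a ∷ p) (b ∷ q) zero    = refl
  coeff-+P (a ∷ p) (b ∷ q) (suc n) = coeff-+P p q n

  coeff-·P : ∀ a p n → coeff (a ·P p) n ≈ a * coeff p n
  coeff-·P a []      n       = sym (zeroʳ a)
  coeff-·P a (b ∷ p) zero    = refl
  coeff-·P a (b ∷ p) (suc n) = coeff-·P a p n

  coeff-[0#] : ∀ n → coeff (0# ∷ []) n ≡ 0#
  coeff-[0#] zero    = ≡.refl
  coeff-[0#] (suc n) = ≡.refl

  coeff-∷ʳ-last : ∀ cs u → coeff (cs ∷ʳ u) (length cs) ≡ u
  coeff-∷ʳ-last []       u = ≡.refl
  coeff-∷ʳ-last (_ ∷ cs) u = coeff-∷ʳ-last cs u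

  coeff-∷ʳ-beyond : ∀ cs u {m} → length cs < m → coeff (cs ∷ʳ u) m ≡ 0#
  coeff-∷ʳ-beyond []       u {suc m} _       = ≡.refl
  coeff-∷ʳ-beyond (_ ∷ cs) u {suc m} (s≤s l) = coeff-∷ʳ-beyond cs u l

  coeff-*P-top : ∀ hs t cs u → coeff ((hs ∷ʳ t) *P (cs ∷ʳ u)) (length hs ℕ.+ length cs) ≈ t * u
  coeff-*P-top [] t cs u = begin
    coeff ((t ·P f) +P (0# ∷ [])) d          ≈⟨ coeff-+P (t ·P f) (0# ∷ []) d ⟩
    coeff (t ·P f) d + coeff (0# ∷ []) d     ≈⟨ +-cong (coeff-·P t f d) (reflexive (coeff-[0#] d)) ⟩
    t * coeff f d + 0#                       ≈⟨ +-identityʳ _ ⟩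
    t * coeff f d                            ≡⟨ ≡.cong (t *_) (coeff-∷ʳ-last cs u) ⟩
    t * u                                    ∎
    where open SetoidReasoning setoid
          f = cs ∷ʳ u
          d = length cs
  coeff-*P-top (a ∷ hs) t cs u = begin
    coeff ((a ·P f) +P (0# ∷ ((hs ∷ʳ t) *P f))) (suc m) ≈⟨ coeff-+P (a ·P f) _ (suc m) ⟩
    coeff (a ·P f) (suc m) + coeff ((hs ∷ʳ t) *P f) m
      ≈⟨ +-cong (coeff-·P a f (suc m)) (coeff-*P-top hs t cs u) ⟩
    a * coeff f (suc m) + t * u
      ≡⟨ ≡.cong (λ x → a * x + t * u) (coeff-∷ʳ-beyond cs u (s≤s (m≤n+m _ _))) ⟩
    a * 0# + t * u                                      ≈⟨ +-congʳ (zeroʳ a) ⟩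
    0# + t * u                                          ≈⟨ +-identityˡ _ ⟩
    t * u                                               ∎
    where open SetoidReasoning setoid
          f = cs ∷ʳ u
          m = length hs ℕ.+ length cs

  record Coeffwise {ℓ′} (_~_ : Rel Carrier ℓ′) (p q : Poly) : Set ℓ′ where
    constructor coeffwise
    field at : ∀ n → coeff p n ~ coeff q n
  open Coeffwise public

  Coeffwise-map : ∀ {ℓ₁ ℓ₂} {_~₁_ : Rel Carrier ℓ₁} {_~₂_ : Rel Carrier ℓ₂} →
                  _~₁_ ⇒ _~₂_ → Coeffwise _~₁_ ⇒ Coeffwise _~₂_
  Coeffwise-map f e = coeffwise λ n → f (at e n)

  module Modulo {ℓ′} {_~_ : Rel Carrier ℓ′} (~-isCongruence : IsCongruence _~_) where
    private
      module C = IsCongruence ~-isCongruence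
      module ~ = IsEquivalence C.isEquivalence

    infix 4 _≋_
    _≋_ : Rel Poly ℓ′
    _≋_ = Coeffwise _~_

    ≋-isEquivalence : IsEquivalence _≋_
    ≋-isEquivalence = record
      { refl  = coeffwise λ n → ~.refl
      ; sym   = λ e → coeffwise λ n → ~.sym (at e n)
      ; trans = λ e f → coeffwise λ n → ~.trans (at e n) (at f n)
      }

    ≋-setoid : Setoid c ℓ′
    ≋-setoid = record { isEquivalence = ≋-isEquivalence }

    open IsEquivalence ≋-isEquivalence public
      using () renaming (refl to ≋-refl; sym to ≋-sym; trans to ≋-trans)

    coeffwise-≈ : ∀ {p q} → (∀ n → coeff p n ≈ coeff q n) → p ≋ q
    coeffwise-≈ e = coeffwise λ n → C.≈⇒~ (e n)

    fromPolyEq : ∀ p q → PolyEq _~_ p q → p ≋ q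
    fromPolyEq p q e = coeffwise (go p q e)
      where
        go : ∀ p q → PolyEq _~_ p q → ∀ n → coeff p n ~ coeff q n
        go []      []      _       n       = ~.refl
        go []      (b ∷ q) (e , _) zero    = e
        go []      (b ∷ q) (_ , e) (suc n) = go [] q e n
        go (a ∷ p) []      (e , _) zero    = e
        go (a ∷ p) []      (_ , e) (suc n) = go p [] e n
        go (a ∷ p) (b ∷ q) (e , _) zero    = e
        go (a ∷ p) (b ∷ q) (_ , e) (suc n) = go p q e n

    toPolyEq : ∀ p q → p ≋ q → PolyEq _~_ p q
    toPolyEq []      []      e = tt
    toPolyEq []      (b ∷ q) e = at e 0 , toPolyEq [] q (coeffwise λ n → at e (suc n))
    toPolyEq (a ∷ p) []      e = at e 0 , toPolyEq p [] (coeffwise λ n → at e (suc n))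
    toPolyEq (a ∷ p) (b ∷ q) e = at e 0 , toPolyEq p q (coeffwise λ n → at e (suc n))

    ∷-cong : ∀ {a b p q} → a ~ b → p ≋ q → (a ∷ p) ≋ (b ∷ q)
    ∷-cong a~b p≋q = coeffwise λ { zero → a~b ; (suc n) → at p≋q n }

    0∷-cong : ∀ {p q} → p ≋ q → (0# ∷ p) ≋ (0# ∷ q)
    0∷-cong = ∷-cong ~.refl

    +P-cong : ∀ {p p′ q q′} → p ≋ p′ → q ≋ q′ → (p +P q) ≋ (p′ +P q′)
    +P-cong {p} {p′} {q} {q′} e f = coeffwise λ n →
      ~.trans (C.≈⇒~ (coeff-+P p q n))
        (~.trans (C.+-cong (at e n) (at f n)) (C.≈⇒~ (sym (coeff-+P p′ q′ n))))

    ·P-cong : ∀ {a b p q} → a ~ b → p ≋ q → (a ·P p) ≋ (b ·P q)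
    ·P-cong {a} {b} {p} {q} a~b e = coeffwise λ n →
      ~.trans (C.≈⇒~ (coeff-·P a p n))
        (~.trans (C.*-cong a~b (at e n)) (C.≈⇒~ (sym (coeff-·P b q n))))

    +P-comm : ∀ p q → (p +P q) ≋ (q +P p)
    +P-comm p q = coeffwise-≈ λ n → begin
      coeff (p +P q) n         ≈⟨ coeff-+P p q n ⟩
      coeff p n + coeff q n    ≈⟨ +-comm _ _ ⟩
      coeff q n + coeff p n    ≈⟨ coeff-+P q p n ⟨
      coeff (q +P p) n         ∎
      where open SetoidReasoning setoid

    +P-assoc : ∀ p q r → ((p +P q) +P r) ≋ (p +P (q +P r))
    +P-assoc p q r = coeffwise-≈ λ n → begin
      coeff ((p +P q) +P r) n                ≈⟨ coeff-+P (p +P q) r n ⟩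
      coeff (p +P q) n + coeff r n           ≈⟨ +-congʳ (coeff-+P p q n) ⟩
      (coeff p n + coeff q n) + coeff r n    ≈⟨ +-assoc _ _ _ ⟩
      coeff p n + (coeff q n + coeff r n)    ≈⟨ +-congˡ (coeff-+P q r n) ⟨
      coeff p n + coeff (q +P r) n           ≈⟨ coeff-+P p (q +P r) n ⟨
      coeff (p +P (q +P r)) n                ∎
      where open SetoidReasoning setoid

    +P-identityʳ : ∀ p → (p +P []) ≋ p
    +P-identityʳ p = coeffwise-≈ λ n → trans (coeff-+P p [] n) (+-identityʳ _)

    +P-commutativeMonoid : CommutativeMonoid c ℓ′
    +P-commutativeMonoid = record
      { Carrier = Poly ; _≈_ = _≋_ ; _∙_ = _+P_ ; ε = []
      ; isCommutativeMonoid = record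
          { isMonoid = record
              { isSemigroup = record
                  { isMagma = record { isEquivalence = ≋-isEquivalence ; ∙-cong = +P-cong }
                  ; assoc = +P-assoc }
              ; identity = (λ p → ≋-refl) , +P-identityʳ }
          ; comm = +P-comm }
      }

    open import Algebra.Properties.CommutativeSemigroup
      (CommutativeMonoid.commutativeSemigroup +P-commutativeMonoid)
      using () renaming (interchange to +P-interchange; x∙yz≈y∙xz to +P-x∙yz≈y∙xz)

    ·P-distribˡ : ∀ a p q → (a ·P (p +P q)) ≋ ((a ·P p) +P (a ·P q))
    ·P-distribˡ a p q = coeffwise-≈ λ n → begin
      coeff (a ·P (p +P q)) n                ≈⟨ coeff-·P a (p +P q) n ⟩
      a * coeff (p +P q) n                   ≈⟨ *-congˡ (coeff-+P p q n) ⟩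
      a * (coeff p n + coeff q n)            ≈⟨ distribˡ _ _ _ ⟩
      a * coeff p n + a * coeff q n          ≈⟨ +-cong (coeff-·P a p n) (coeff-·P a q n) ⟨
      coeff (a ·P p) n + coeff (a ·P q) n    ≈⟨ coeff-+P (a ·P p) (a ·P q) n ⟨
      coeff ((a ·P p) +P (a ·P q)) n         ∎
      where open SetoidReasoning setoid

    ·P-distribʳ : ∀ a b p → ((a + b) ·P p) ≋ ((a ·P p) +P (b ·P p))
    ·P-distribʳ a b p = coeffwise-≈ λ n → begin
      coeff ((a + b) ·P p) n                 ≈⟨ coeff-·P (a + b) p n ⟩
      (a + b) * coeff p n                    ≈⟨ distribʳ _ _ _ ⟩
      a * coeff p n + b * coeff p n          ≈⟨ +-cong (coeff-·P a p n) (coeff-·P b p n) ⟨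
      coeff (a ·P p) n + coeff (b ·P p) n    ≈⟨ coeff-+P (a ·P p) (b ·P p) n ⟨
      coeff ((a ·P p) +P (b ·P p)) n         ∎
      where open SetoidReasoning setoid

    ·P-assoc : ∀ a b p → (a ·P (b ·P p)) ≋ ((a * b) ·P p)
    ·P-assoc a b p = coeffwise-≈ λ n → begin
      coeff (a ·P (b ·P p)) n    ≈⟨ coeff-·P a (b ·P p) n ⟩
      a * coeff (b ·P p) n       ≈⟨ *-congˡ (coeff-·P b p n) ⟩
      a * (b * coeff p n)        ≈⟨ *-assoc _ _ _ ⟨
      (a * b) * coeff p n        ≈⟨ coeff-·P (a * b) p n ⟨
      coeff ((a * b) ·P p) n     ∎
      where open SetoidReasoning setoid

    ·P-zeroˡ : ∀ p → (0# ·P p) ≋ []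
    ·P-zeroˡ p = coeffwise-≈ λ n → trans (coeff-·P 0# p n) (zeroˡ _)

    ·P-identityˡ : ∀ p → (1# ·P p) ≋ p
    ·P-identityˡ p = coeffwise-≈ λ n → trans (coeff-·P 1# p n) (*-identityˡ _)

    +P-[0#] : ∀ p → (p +P (0# ∷ [])) ≋ p
    +P-[0#] p = coeffwise-≈ λ n →
      trans (coeff-+P p (0# ∷ []) n) (trans (+-congˡ (reflexive (coeff-[0#] n))) (+-identityʳ _))

    0∷-+P : ∀ p q → ((0# ∷ p) +P (0# ∷ q)) ≋ (0# ∷ (p +P q))
    0∷-+P p q = ∷-cong (C.≈⇒~ (+-identityʳ 0#)) ≋-refl

    ·P-0∷ : ∀ a p → (a ·P (0# ∷ p)) ≋ (0# ∷ (a ·P p))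
    ·P-0∷ a p = ∷-cong (C.≈⇒~ (zeroʳ a)) ≋-refl

    0∷-*P : ∀ p q → ((0# ∷ p) *P q) ≋ (0# ∷ (p *P q))
    0∷-*P p q = +P-cong (·P-zeroˡ q) ≋-refl

    []≋[0#]*P : ∀ q → [] ≋ ((0# ∷ []) *P q)
    []≋[0#]*P q =
      ≋-sym (≋-trans (+P-cong (·P-zeroˡ q) ≋-refl) (coeffwise-≈ λ n → reflexive (coeff-[0#] n)))

    ∷-*P-cong : ∀ q {a b} p p′ → a ~ b → (p *P q) ≋ (p′ *P q) → ((a ∷ p) *P q) ≋ ((b ∷ p′) *P q)
    ∷-*P-cong q p p′ a~b e = +P-cong (·P-cong a~b ≋-refl) (0∷-cong e)

    *P-congˡ : ∀ q {p p′} → p ≋ p′ → (p *P q) ≋ (p′ *P q)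
    *P-congˡ q {[]}    {[]}     _ = ≋-refl
    *P-congˡ q {[]}    {b ∷ p′} e =
      ≋-trans ([]≋[0#]*P q)
              (∷-*P-cong q [] p′ (at e 0) (*P-congˡ q {[]} {p′} (coeffwise λ n → at e (suc n))))
    *P-congˡ q {a ∷ p} {[]}     e =
      ≋-trans (∷-*P-cong q p [] (at e 0) (*P-congˡ q {p} {[]} (coeffwise λ n → at e (suc n))))
              (≋-sym ([]≋[0#]*P q))
    *P-congˡ q {a ∷ p} {b ∷ p′} e =
      ∷-*P-cong q p p′ (at e 0) (*P-congˡ q {p} {p′} (coeffwise λ n → at e (suc n)))

    *P-zeroʳ : ∀ p → (p *P []) ≋ []
    *P-zeroʳ []      = ≋-refl
    *P-zeroʳ (a ∷ p) = ≋-trans (0∷-cong (*P-zeroʳ p)) (coeffwise-≈ λ { zero → refl ; (suc n) → refl })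

    *P-consʳ : ∀ p b q → (p *P (b ∷ q)) ≋ ((b ·P p) +P (0# ∷ (p *P q)))
    *P-consʳ []      b q = coeffwise-≈ λ { zero → refl ; (suc n) → refl }
    *P-consʳ (a ∷ p) b q = ∷-cong (C.≈⇒~ (+-congʳ (*-comm a b))) (begin
      (a ·P q) +P (p *P (b ∷ q))                 ≈⟨ +P-cong ≋-refl (*P-consʳ p b q) ⟩
      (a ·P q) +P ((b ·P p) +P (0# ∷ (p *P q)))  ≈⟨ +P-x∙yz≈y∙xz (a ·P q) (b ·P p) _ ⟩
      (b ·P p) +P ((a ·P q) +P (0# ∷ (p *P q)))  ∎)
      where open SetoidReasoning ≋-setoid

    *P-comm : ∀ p q → (p *P q) ≋ (q *P p)
    *P-comm []      q = ≋-sym (*P-zeroʳ q)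
    *P-comm (a ∷ p) q = ≋-trans (+P-cong ≋-refl (0∷-cong (*P-comm p q))) (≋-sym (*P-consʳ q a p))

    ·P-*P : ∀ a p q → ((a ·P p) *P q) ≋ (a ·P (p *P q))
    ·P-*P a []      q = ≋-refl
    ·P-*P a (b ∷ p) q = begin
      ((a * b) ·P q) +P (0# ∷ ((a ·P p) *P q))
        ≈⟨ +P-cong (≋-sym (·P-assoc a b q)) (0∷-cong (·P-*P a p q)) ⟩
      (a ·P (b ·P q)) +P (0# ∷ (a ·P (p *P q)))
        ≈⟨ +P-cong ≋-refl (≋-sym (·P-0∷ a (p *P q))) ⟩
      (a ·P (b ·P q)) +P (a ·P (0# ∷ (p *P q)))
        ≈⟨ ·P-distribˡ a (b ·P q) _ ⟨
      a ·P ((b ·P q) +P (0# ∷ (p *P q)))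
        ∎
      where open SetoidReasoning ≋-setoid

    *P-distribʳ : ∀ r p q → ((p +P q) *P r) ≋ ((p *P r) +P (q *P r))
    *P-distribʳ r []      q       = ≋-refl
    *P-distribʳ r (a ∷ p) []      = ≋-sym (+P-identityʳ _)
    *P-distribʳ r (a ∷ p) (b ∷ q) = begin
      ((a + b) ·P r) +P (0# ∷ ((p +P q) *P r))
        ≈⟨ +P-cong (·P-distribʳ a b r) (0∷-cong (*P-distribʳ r p q)) ⟩
      ((a ·P r) +P (b ·P r)) +P (0# ∷ ((p *P r) +P (q *P r)))
        ≈⟨ +P-cong ≋-refl (0∷-+P (p *P r) (q *P r)) ⟨
      ((a ·P r) +P (b ·P r)) +P ((0# ∷ (p *P r)) +P (0# ∷ (q *P r)))
        ≈⟨ +P-interchange (a ·P r) (b ·P r) _ _ ⟩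
      ((a ·P r) +P (0# ∷ (p *P r))) +P ((b ·P r) +P (0# ∷ (q *P r)))
        ∎
      where open SetoidReasoning ≋-setoid

    *P-assoc : ∀ p q r → ((p *P q) *P r) ≋ (p *P (q *P r))
    *P-assoc []      q r = ≋-refl
    *P-assoc (a ∷ p) q r = begin
      ((a ·P q) +P (0# ∷ (p *P q))) *P r          ≈⟨ *P-distribʳ r (a ·P q) _ ⟩
      ((a ·P q) *P r) +P ((0# ∷ (p *P q)) *P r)   ≈⟨ +P-cong (·P-*P a q r) (0∷-*P (p *P q) r) ⟩
      (a ·P (q *P r)) +P (0# ∷ ((p *P q) *P r))   ≈⟨ +P-cong ≋-refl (0∷-cong (*P-assoc p q r)) ⟩
      (a ·P (q *P r)) +P (0# ∷ (p *P (q *P r)))   ∎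
      where open SetoidReasoning ≋-setoid

    *P-·P : ∀ p a q → (p *P (a ·P q)) ≋ (a ·P (p *P q))
    *P-·P p a q = ≋-trans (*P-comm p (a ·P q)) (≋-trans (·P-*P a q p) (·P-cong ~.refl (*P-comm q p)))

    *P-identityˡ : ∀ p → ((1# ∷ []) *P p) ≋ p
    *P-identityˡ p = ≋-trans (+P-[0#] (1# ·P p)) (·P-identityˡ p)

    *P-congʳ : ∀ p {q q′} → q ≋ q′ → (p *P q) ≋ (p *P q′)
    *P-congʳ p {q} {q′} q≋q′ = ≋-trans (*P-comm p q) (≋-trans (*P-congˡ p q≋q′) (*P-comm q′ p))

    *P-+P-commutativeSemiring : CommutativeSemiring c ℓ′
    *P-+P-commutativeSemiring = record
      { Carrier = Poly ; _≈_ = _≋_ ; _+_ = _+P_ ; _*_ = _*P_ ; 0# = [] ; 1# = 1# ∷ []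
      ; isCommutativeSemiring = record
          { isSemiring = record
              { isSemiringWithoutAnnihilatingZero = record
                  { +-isCommutativeMonoid = CommutativeMonoid.isCommutativeMonoid +P-commutativeMonoid
                  ; *-cong     = λ {p} {p′} {q} p≋p′ q≋q′ → ≋-trans (*P-congˡ q p≋p′) (*P-congʳ p′ q≋q′)
                  ; *-assoc    = *P-assoc
                  ; *-identity = *P-identityˡ , λ p → ≋-trans (*P-comm p _) (*P-identityˡ p)
                  ; distrib    = (λ r p q → ≋-trans (*P-comm r _)
                                   (≋-trans (*P-distribʳ r p q) (+P-cong (*P-comm p r) (*P-comm q r))))
                               , *P-distribʳ
                  }
              ; zero = (λ p → ≋-refl) , *P-zeroʳ
              }
          ; *-comm = *P-comm
          }
      }

    ∷ʳ-zero : ∀ hs {t} → t ~ 0# → (hs ∷ʳ t) ≋ hs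
    ∷ʳ-zero []       t~0 = coeffwise λ { zero → t~0 ; (suc n) → ~.refl }
    ∷ʳ-zero (a ∷ hs) t~0 = ∷-cong ~.refl (∷ʳ-zero hs t~0)

    -- The top coefficient of h equals that of h * q, so it vanishes and can be peeled off.
    monic-cancelʳ : ∀ {q} → Monic q → ∀ {h} → (h *P q) ≋ [] → h ≋ []
    monic-cancelʳ {q} (cs , u , ≡.refl , u≈1) {h} = go (reverseView h)
      where
        go : ∀ {h} → Reverse h → (h *P q) ≋ [] → h ≋ []
        go []               _      = ≋-refl
        go (hs ∶ hs′ ∶ʳ t) hq≋[] = ≋-trans (∷ʳ-zero hs t~0) (go hs′ hsq≋[])
          where
            t~0 : t ~ 0#
            t~0 = ~.trans (C.≈⇒~ (begin
                    t                                                  ≈⟨ *-identityʳ t ⟨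
                    t * 1#                                             ≈⟨ *-congˡ u≈1 ⟨
                    t * u                                              ≈⟨ coeff-*P-top hs t cs u ⟨
                    coeff ((hs ∷ʳ t) *P q) (length hs ℕ.+ length cs)   ∎))
                  (at hq≋[] _)
              where open SetoidReasoning setoid
            hsq≋[] : (hs *P q) ≋ []
            hsq≋[] = ≋-trans (*P-congˡ q (≋-sym (∷ʳ-zero hs t~0))) hq≋[]

    coprime-divisors⇒product-∣ : ∀ f q₁ q₂ s₁ s₂ a b → f ≋ (q₁ *P s₁) → f ≋ (q₂ *P s₂) →
                  ((a *P q₁) +P (b *P q₂)) ≋ (1# ∷ []) →
                  f ≋ ((q₁ *P q₂) *P ((a *P s₂) +P (b *P s₁)))
    coprime-divisors⇒product-∣ f q₁ q₂ s₁ s₂ a b f≋q₁s₁ f≋q₂s₂ aq₁+bq₂≋1 = begin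
      f                                                  ≈⟨ P.*-identityˡ f ⟨
      (1# ∷ []) *P f                                     ≈⟨ P.*-congʳ aq₁+bq₂≋1 ⟨
      ((a *P q₁) +P (b *P q₂)) *P f                      ≈⟨ P.distribʳ f (a *P q₁) (b *P q₂) ⟩
      ((a *P q₁) *P f) +P ((b *P q₂) *P f)
        ≈⟨ P.+-cong (P.*-congˡ {a *P q₁} f≋q₂s₂) (P.*-congˡ {b *P q₂} f≋q₁s₁) ⟩
      ((a *P q₁) *P (q₂ *P s₂)) +P ((b *P q₂) *P (q₁ *P s₁))
        ≈⟨ P.+-cong (≋-trans (P.*-congʳ (P.*-comm a q₁)) (*P-interchange q₁ a q₂ s₂))
                    (≋-trans (P.*-congʳ (P.*-comm b q₂))
                       (≋-trans (*P-interchange q₂ b q₁ s₁) (P.*-congʳ (P.*-comm q₂ q₁)))) ⟩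
      ((q₁ *P q₂) *P (a *P s₂)) +P ((q₁ *P q₂) *P (b *P s₁)) ≈⟨ P.distribˡ (q₁ *P q₂) _ _ ⟨
      (q₁ *P q₂) *P ((a *P s₂) +P (b *P s₁))             ∎
      where
        module P = CommutativeSemiring *P-+P-commutativeSemiring
        open import Algebra.Properties.CommutativeSemigroup P.*-commutativeSemigroup
          using () renaming (interchange to *P-interchange)
        open SetoidReasoning ≋-setoid

  open Modulo ≈-isCongruence using (_≋_; ≋-refl; ≋-sym; ≋-trans; ∷-cong; *P-comm; *P-congʳ; *P-·P)
  module ModuloMultiples (d : Carrier) = Modulo (ideal⇒isCongruence (multiples-isIdeal d))

  x-0#≈x : ∀ x → x - 0# ≈ x
  x-0#≈x x = trans (+-congˡ (ε⁻¹≈ε)) (+-identityʳ x)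

  divide-coefficients : ∀ d h → ModuloMultiples._≋_ d h [] → Σ Poly λ h′ → h ≋ (d ·P h′)
  divide-coefficients d []      _    = [] , ≋-refl
  divide-coefficients d (a ∷ h) h≡0
    with at h≡0 0 | divide-coefficients d h (coeffwise λ n → at h≡0 (suc n))
  ... | r , a-0≈dr | h′ , h≋dh′ = r ∷ h′ , ∷-cong (trans (sym (x-0#≈x a)) a-0≈dr) h≋dh′

  -- Modulo d the product h q vanishes, so monic cancellation makes h a multiple of d.
  monic-cofactor-divisible : ∀ d f q h → Monic q → (d ·P f) ≋ (q *P h) → Σ Poly λ h′ → h ≋ (d ·P h′)
  monic-cofactor-divisible d f q h q-monic df≋qh =
    divide-coefficients d h (ModuloMultiples.monic-cancelʳ d q-monic hq≡0)
    where
      hq≋df : (h *P q) ≋ (d ·P f)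
      hq≋df = ≋-trans (*P-comm h q) (≋-sym df≋qh)
      hq≡0 : ModuloMultiples._≋_ d (h *P q) []
      hq≡0 = coeffwise λ n → coeff f n , trans (x-0#≈x _) (trans (at hq≋df n) (coeff-·P d f n))

  monic-∣-scaled⇒∣-mod-Ann : ∀ d f g q h → Monic q → g ≋ (d ·P f) → g ≋ (q *P h) →
                            Σ Poly λ s → Coeffwise (CongruentModAnn d) f (q *P s)
  monic-∣-scaled⇒∣-mod-Ann d f g q h q-monic g≋df g≋qh
    with monic-cofactor-divisible d f q h q-monic (≋-trans (≋-sym g≋df) g≋qh)
  ... | h′ , h≋dh′ = h′ , coeffwise λ n →
    trans (x[y-z]≈xy-xz d _ _) (x≈y⇒x∙y⁻¹≈ε (begin
      d * coeff f n                ≈⟨ coeff-·P d f n ⟨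
      coeff (d ·P f) n             ≈⟨ at df≋dqh′ n ⟩
      coeff (d ·P (q *P h′)) n     ≈⟨ coeff-·P d (q *P h′) n ⟩
      d * coeff (q *P h′) n        ∎))
    where
      open SetoidReasoning setoid
      df≋dqh′ : (d ·P f) ≋ (d ·P (q *P h′))
      df≋dqh′ = ≋-trans (≋-sym g≋df) (≋-trans g≋qh (≋-trans (*P-congʳ q h≋dh′) (*P-·P q d h′)))

  coprime-monic-divisors-of-scaled⇒product-∣ :
    ∀ {ℓ′} {_~_ : Rel Carrier ℓ′} (~-isCongruence : IsCongruence _~_) d →
    CongruentModAnn d ⇒ _~_ →
    ∀ f g q₁ q₂ h₁ h₂ a b → Monic q₁ → Monic q₂ →
    g ≋ (d ·P f) → g ≋ (q₁ *P h₁) → g ≋ (q₂ *P h₂) →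
    Modulo._≋_ ~-isCongruence ((a *P q₁) +P (b *P q₂)) (1# ∷ []) →
    Σ Poly λ s → Modulo._≋_ ~-isCongruence f ((q₁ *P q₂) *P s)
  coprime-monic-divisors-of-scaled⇒product-∣ ~-isCongruence d ann⊆~ f g q₁ q₂ h₁ h₂ a b
                                              q₁-monic q₂-monic g≋df g≋q₁h₁ g≋q₂h₂ aq₁+bq₂≡1
    with monic-∣-scaled⇒∣-mod-Ann d f g q₁ h₁ q₁-monic g≋df g≋q₁h₁
       | monic-∣-scaled⇒∣-mod-Ann d f g q₂ h₂ q₂-monic g≋df g≋q₂h₂
  ... | s₁ , f≡q₁s₁ | s₂ , f≡q₂s₂ =
    (a *P s₂) +P (b *P s₁) ,
    coprime-divisors⇒product-∣ f q₁ q₂ s₁ s₂ a b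
      (Coeffwise-map ann⊆~ f≡q₁s₁) (Coeffwise-map ann⊆~ f≡q₂s₂) aq₁+bq₂≡1
    where open Modulo ~-isCongruence using (coprime-divisors⇒product-∣)

open import Data.Nat using (_+_)

lemma6 : ∀ {c ℓ : Level} (R : CommutativeRing c ℓ) →
    let open CommutativeRing R using (1#)
        open RingDefs R
    in (p α : ℕ) → Prime p → IsLocal → HasCharacteristic (p ^ α) →
       (k : ℕ) (g ĝ : Poly) →
       g ≈P (ℕ→R (p ^ k) ·P ĝ) →
       ¬ (Σ Poly λ h → g ≈P (ℕ→R (p ^ (k + 1)) ·P h)) →
       (q₁ q₂ : Poly) → Monic q₁ → Monic q₂ → q₁ ∣P g → q₂ ∣P g →
       (a b : Poly) → ((a *P q₁) +P (b *P q₂)) ≈Q[ p , k ] (1# ∷ []) →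
       (q₁ *P q₂) ∣Q[ p , k ] ĝ
lemma6 R p _ _ _ _ k g ĝ g≈pᵏĝ _ q₁ q₂ q₁-monic q₂-monic (h₁ , g≈q₁h₁) (h₂ , g≈q₂h₂) a b aq₁+bq₂≡1 =
  map₂ (Q.toPolyEq ĝ _)
    (coprime-monic-divisors-of-scaled⇒product-∣ Q-isCongruence (ℕ→R (p ^ k)) ann⊆Q
      ĝ g q₁ q₂ h₁ h₂ a b q₁-monic q₂-monic
      (≈.fromPolyEq _ _ g≈pᵏĝ) (≈.fromPolyEq _ _ g≈q₁h₁) (≈.fromPolyEq _ _ g≈q₂h₂)
      (Q.fromPolyEq _ _ aq₁+bq₂≡1))
  where
    open CommutativeRing R
    open RingDefs R
    open Polynomials R
    Q-isCongruence : IsCongruence (_≡[mod-Î+pR]_ p k)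
    Q-isCongruence = ideal⇒isCongruence (annPlusMultiples-isIdeal (ℕ→R (p ^ k)) (ℕ→R p))
    module ≈ = Modulo ≈-isCongruence
    module Q = Modulo Q-isCongruence

    ann⊆Q : CongruentModAnn (ℕ→R (p ^ k)) ⇒ _≡[mod-Î+pR]_ p k
    ann⊆Q pᵏ[x-y]≈0 = _ , 0# , pᵏ[x-y]≈0 , sym (trans (+-congˡ (zeroʳ _)) (+-identityʳ _))
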